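{- Let $G\in\mathcal{C}_{\mathcal{P}\mathcal{S}\overline{\mathcal{S}}}$ with $|V(G)|\geq 4$. Then $G$ is connected.
   Context: All graphs are finite and simple; $d(v)$ denotes degree. For $T\subseteq V(G)$, an orientation is $T$-odd if every vertex $v$ has odd in-degree iff $v\in T$; acyclic means no directed cycle. $Source(T)=V(G)\setminus T$, $Sink(T)=\{v\in T: d(v)\text{ odd}\}\cup\{v\notin T: d(v)\text{ even}\}$. $(\mathcal{P})$: $|E(G)|+|T|$ even. $(\mathcal{S})$: $Source(T)\neq\emptyset$ and if $|Source(T)|=1$ then $|V(G)|=1$ or $Source(T)\neq Sink(T)$. $(\overline{\mathcal{S}})$: $Sink(T)\neq\emptyset$ and if $|Sink(T)|=1$ then $|V(G)|=1$ or $Sink(T)\neq Source(T)$. $\mathcal{C}_{\mathcal{P}\mathcal{S}\overline{\mathcal{S}}}$ is the class of graphs $G$ admitting an acyclic $T$-odd orientation for every $T\subseteq V(G)$ satisfying $\mathcal{P}$, $\mathcal{S}$ and $\overline{\mathcal{S}}$. -}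

module Defs where

open import Data.Nat using (ℕ; zero; suc; _+_; _<ᵇ_; _≥_)
open import Data.Fin using (Fin; zero; suc; toℕ)
open import Data.Bool using (Bool; true; false; _∧_; not; if_then_else_)
open import Data.Product using (_×_; Σ)
open import Data.Sum using (_⊎_)
open import Relation.Nullary using (¬_)
open import Relation.Binary.PropositionalEquality using (_≡_)
open import Relation.Binary.Construct.Closure.Transitive using (TransClosure)
open import Relation.Binary.Construct.Closure.ReflexiveTransitive using (Star)

record Graph (n : ℕ) : Set where
  field
    adj   : Fin n → Fin n → Bool
    sym   : ∀ u v → adj u v ≡ adj v u
    irref : ∀ v → adj v v ≡ false
open Graph public

count : ∀ {n} → (Fin n → Bool) → ℕ
count {zero}  P = 0
count {suc n} P = (if P zero then 1 else 0) + count (λ i → P (suc i))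

isOdd : ℕ → Bool
isOdd zero          = false
isOdd (suc zero)    = true
isOdd (suc (suc k)) = isOdd k

deg : ∀ {n} → Graph n → Fin n → ℕ
deg G v = count (adj G v)

numEdges : ∀ {n} → Graph n → ℕ
numEdges {n} G = sumOver (λ u → count (λ v → adj G u v ∧ (toℕ u <ᵇ toℕ v)))
  where
  sumOver : ∀ {m} → (Fin m → ℕ) → ℕ
  sumOver {zero}  f = 0
  sumOver {suc m} f = f zero + sumOver (λ i → f (suc i))

record Orientation {n : ℕ} (G : Graph n) : Set where
  field
    arc       : Fin n → Fin n → Bool
    arc-edge  : ∀ u v → arc u v ≡ true → adj G u v ≡ true
    one-dir   : ∀ u v → adj G u v ≡ true → (arc u v ≡ true × arc v u ≡ false) ⊎ (arc u v ≡ false × arc v u ≡ true)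
open Orientation public

Arc : ∀ {n} {G : Graph n} → Orientation G → Fin n → Fin n → Set
Arc O u v = arc O u v ≡ true

indeg : ∀ {n} {G : Graph n} → Orientation G → Fin n → ℕ
indeg O v = count (λ u → arc O u v)

IsTOdd : ∀ {n} {G : Graph n} → (Fin n → Bool) → Orientation G → Set
IsTOdd T O = ∀ v → isOdd (indeg O v) ≡ T v

Acyclic : ∀ {n} {G : Graph n} → Orientation G → Set
Acyclic O = ∀ v → ¬ TransClosure (Arc O) v v

Source : ∀ {n} → (Fin n → Bool) → Fin n → Bool
Source T v = not (T v)

Sink : ∀ {n} → Graph n → (Fin n → Bool) → Fin n → Bool
Sink G T v = if T v then isOdd (deg G v) else not (isOdd (deg G v))

CondP : ∀ {n} → Graph n → (Fin n → Bool) → Set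
CondP G T = isOdd (numEdges G + count T) ≡ false

CondS : ∀ {n} → Graph n → (Fin n → Bool) → Set
CondS {n} G T = ¬ (count (Source T) ≡ 0)
  × (count (Source T) ≡ 1 → n ≡ 1 ⊎ ¬ (∀ v → Source T v ≡ Sink G T v))

CondSbar : ∀ {n} → Graph n → (Fin n → Bool) → Set
CondSbar {n} G T = ¬ (count (Sink G T) ≡ 0)
  × (count (Sink G T) ≡ 1 → n ≡ 1 ⊎ ¬ (∀ v → Sink G T v ≡ Source T v))

InC-PSSbar : ∀ {n} → Graph n → Set
InC-PSSbar G = ∀ (T : _ → Bool) → CondP G T → CondS G T → CondSbar G T →
  Σ (Orientation G) (λ O → IsTOdd T O × Acyclic O)

Connected : ∀ {n} → Graph n → Set
Connected G = ∀ u v → Star (λ x y → adj G x y ≡ true) u v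

-- If T = V ∖ M satisfies (P), (S) and (S̄), an acyclic T-odd orientation exists; following arcs
-- backwards from any vertex ends at a source, whose in-degree 0 is even, so it lies in M.  Hence
-- every component of G meets M.  Choose M of size 1, 2 or 3 according to the parity of |E| + |V|:
-- either M is a vertex u with some neighbours, and then u is joined to every vertex, or M avoids an
-- isolated vertex, which is then impossible.  (S) and (S̄) are secured by putting a sink in V ∖ M
-- or by |M| ≥ 2 and a sink anywhere, which the parities of the degrees allow once |V| ≥ 4.
module Submission where

open import Defs hiding (sym)
open import Data.Nat using (ℕ; zero; suc; _+_; _≤_; _≥_; z≤n; s≤s)
open import Data.Nat.Properties using (+-assoc; +-suc; suc-injective)
open import Data.Fin using (Fin; zero; suc; _≟_; #_)
open import Data.Fin.Properties using (any?)
open import Data.Bool using (Bool; true; false; not; _∧_; _xor_)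
open import Data.Bool.Properties using (not-involutive; ∧-identityʳ; ∧-zeroʳ; ¬-not)
import Data.Bool.Properties as Bool
open import Data.List using (List; []; _∷_; length)
open import Data.List.Membership.Propositional using (_∈_; _∉_)
open import Data.List.Relation.Unary.Any using (here)
import Data.List.Relation.Unary.Any as Any
open import Data.List.Relation.Unary.All using (All; []; _∷_)
import Data.List.Relation.Unary.All as All
open import Data.List.Relation.Unary.All.Properties using (All¬⇒¬Any)
open import Data.List.Relation.Unary.AllPairs using ([]; _∷_)
open import Data.List.Relation.Unary.Unique.Propositional using (Unique)
open import Data.Product using (Σ-syntax; ∃-syntax; _×_; _,_)
open import Data.Sum using (_⊎_; inj₁; inj₂)
import Data.Sum as Sum
open import Function using (_∘_)
open import Data.Empty using (⊥-elim)
open import Relation.Nullary using (¬_; Dec; yes; no; does; contradiction)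
open import Relation.Nullary.Decidable using (dec-true; dec-false; decidable-stable; ¬?; _×-dec_)
open import Relation.Binary.PropositionalEquality
  using (_≡_; _≢_; _≗_; refl; sym; trans; cong; subst; ≢-sym; module ≡-Reasoning)
open import Relation.Binary.Construct.Closure.Transitive using (TransClosure; [_]; _∷_)
open import Relation.Binary.Construct.Closure.ReflexiveTransitive
  using (Star; ε; _◅_; _◅◅_; reverse)
import Relation.Binary.Construct.Closure.ReflexiveTransitive as Star

isOdd-suc : ∀ m → isOdd (suc m) ≡ not (isOdd m)
isOdd-suc zero          = refl
isOdd-suc (suc zero)    = refl
isOdd-suc (suc (suc m)) = isOdd-suc m

isOdd-+ : ∀ m n → isOdd (m + n) ≡ isOdd m xor isOdd n
isOdd-+ zero          n = refl
isOdd-+ (suc zero)    n = isOdd-suc n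
isOdd-+ (suc (suc m)) n = isOdd-+ m n

xor-≡ʳ⇒false : ∀ x y → x xor y ≡ y → x ≡ false
xor-≡ʳ⇒false false _     _  = refl
xor-≡ʳ⇒false true  false ()
xor-≡ʳ⇒false true  true  ()

even⇒≡0⊎≥2 : ∀ {m} → isOdd m ≡ false → m ≡ 0 ⊎ 2 ≤ m
even⇒≡0⊎≥2 {zero}        _  = inj₁ refl
even⇒≡0⊎≥2 {suc zero}    ()
even⇒≡0⊎≥2 {suc (suc m)} _  = inj₂ (s≤s (s≤s z≤n))

_─_ : ∀ {n} → (Fin n → Bool) → Fin n → Fin n → Bool
(P ─ a) x = P x ∧ not (does (x ≟ a))

─-self : ∀ {n} (P : Fin n → Bool) a → (P ─ a) a ≡ false
─-self P a rewrite dec-true (a ≟ a) refl = ∧-zeroʳ (P a)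

─-other : ∀ {n} (P : Fin n → Bool) {a x} → x ≢ a → (P ─ a) x ≡ P x
─-other P {a} {x} x≢a rewrite dec-false (x ≟ a) x≢a = ∧-identityʳ (P x)

─-true : ∀ {n} (P : Fin n → Bool) {a x} → (P ─ a) x ≡ true → x ≢ a × P x ≡ true
─-true P {a} {x} Px = x≢a , trans (sym (─-other P x≢a)) Px
  where
  x≢a : x ≢ a
  x≢a refl = contradiction (trans (sym Px) (─-self P a)) λ ()

count-ext : ∀ {n} {P Q : Fin n → Bool} → P ≗ Q → count P ≡ count Q
count-ext {zero}          _   = refl
count-ext {suc n} {P} {Q} P≗Q rewrite P≗Q zero = cong (_ +_) (count-ext (P≗Q ∘ suc))

count-zero : ∀ {n} (P : Fin n → Bool) → (∀ x → P x ≡ false) → count P ≡ 0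
count-zero {zero}  P _    = refl
count-zero {suc n} P none rewrite none zero = count-zero (P ∘ suc) (none ∘ suc)

count-remove : ∀ {n} (P : Fin n → Bool) {a} → P a ≡ true → count P ≡ suc (count (P ─ a))
count-remove {suc n} P {zero} Pa rewrite Pa =
  cong suc (count-ext (λ x → sym (∧-identityʳ (P (suc x)))))
count-remove {suc n} P {suc a} Pa with P zero | count-remove (P ∘ suc) Pa
... | true  | IH = cong suc IH
... | false | IH = IH

count-nonzero : ∀ {n} (P : Fin n → Bool) {x} → P x ≡ true → count P ≢ 0
count-nonzero P Px count≡0 with () ← trans (sym count≡0) (count-remove P Px)

count-nonzero⇒∃ : ∀ {n} (P : Fin n → Bool) → count P ≢ 0 → ∃[ x ] P x ≡ true
count-nonzero⇒∃ P count≢0 with any? (λ x → P x Bool.≟ true)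
... | yes found = found
... | no  none  = contradiction (count-zero P (λ x → ¬-not (λ Px → none (x , Px)))) count≢0

count≥2⇒∃₂ : ∀ {n} (P : Fin n → Bool) → 2 ≤ count P →
             ∃[ y ] ∃[ z ] y ≢ z × P y ≡ true × P z ≡ true
count≥2⇒∃₂ P 2≤count =
  let y , Py   = count-nonzero⇒∃ P λ count≡0 → contradiction (subst (2 ≤_) count≡0 2≤count) λ ()
      z , P─yz = count-nonzero⇒∃ (P ─ y) λ count≡0 →
        contradiction (subst (2 ≤_) (trans (count-remove P Py) (cong suc count≡0)) 2≤count)
                      λ { (s≤s ()) }
      z≢y , Pz = ─-true P P─yz
  in y , z , ≢-sym z≢y , Py , Pz

count-complement : ∀ {n} (P : Fin n → Bool) → count P + count (not ∘ P) ≡ n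
count-complement {zero}  P = refl
count-complement {suc n} P with P zero
... | true  = cong suc (count-complement (P ∘ suc))
... | false = trans (+-suc _ _) (cong suc (count-complement (P ∘ suc)))

infix 4 _∈?_
_∈?_ : ∀ {n} (x : Fin n) (M : List (Fin n)) → Dec (x ∈ M)
x ∈? M = Any.any? (x ≟_) M

count-∈? : ∀ {n} {M : List (Fin n)} → Unique M → count (λ x → does (x ∈? M)) ≡ length M
count-∈? {n} {[]}    []             = count-zero {n} (λ x → does (x ∈? [])) λ _ → refl
count-∈? {n} {a ∷ M} (a∉M ∷ unique) = begin
  count ∈a∷M             ≡⟨ count-remove ∈a∷M (dec-true (a ∈? a ∷ M) (here refl)) ⟩
  suc (count (∈a∷M ─ a)) ≡⟨ cong suc (count-ext drop-a) ⟩
  suc (count ∈M)         ≡⟨ cong suc (count-∈? unique) ⟩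
  suc (length M)         ∎
  where
  open ≡-Reasoning
  ∈a∷M ∈M : Fin n → Bool
  ∈a∷M x = does (x ∈? a ∷ M)
  ∈M   x = does (x ∈? M)
  drop-a : ∈a∷M ─ a ≗ ∈M
  drop-a x with x ≟ a
  ... | yes refl = sym (dec-false (a ∈? M) (All¬⇒¬Any a∉M))
  ... | no  _    = ∧-identityʳ _

three-others : ∀ {n} → 4 ≤ n → (x : Fin n) →
               Σ[ a ∈ Fin n ] Σ[ b ∈ Fin n ] Σ[ c ∈ Fin n ] Unique (x ∷ a ∷ b ∷ c ∷ [])
three-others (s≤s (s≤s (s≤s (s≤s _)))) zero =
  # 1 , # 2 , # 3 , ((λ ()) ∷ (λ ()) ∷ (λ ()) ∷ []) ∷ ((λ ()) ∷ (λ ()) ∷ []) ∷ ((λ ()) ∷ []) ∷ [] ∷ []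
three-others (s≤s (s≤s (s≤s (s≤s _)))) (suc zero) =
  # 0 , # 2 , # 3 , ((λ ()) ∷ (λ ()) ∷ (λ ()) ∷ []) ∷ ((λ ()) ∷ (λ ()) ∷ []) ∷ ((λ ()) ∷ []) ∷ [] ∷ []
three-others (s≤s (s≤s (s≤s (s≤s _)))) (suc (suc zero)) =
  # 0 , # 1 , # 3 , ((λ ()) ∷ (λ ()) ∷ (λ ()) ∷ []) ∷ ((λ ()) ∷ (λ ()) ∷ []) ∷ ((λ ()) ∷ []) ∷ [] ∷ []
three-others (s≤s (s≤s (s≤s (s≤s _)))) (suc (suc (suc _))) =
  # 0 , # 1 , # 2 , ((λ ()) ∷ (λ ()) ∷ (λ ()) ∷ []) ∷ ((λ ()) ∷ (λ ()) ∷ []) ∷ ((λ ()) ∷ []) ∷ [] ∷ []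

module _ {n} {G : Graph n} (O : Orientation G) (acyclic : Acyclic O) where

  -- Climb backwards along arcs from x.  Vertices outside U lie above x, so by acyclicity the
  -- predecessor of x is in U; removing x from U keeps this invariant and shrinks U.
  reachable-from-source-within : ∀ k (U : Fin n → Bool) {x} → count U ≡ k → U x ≡ true →
    (∀ y → U y ≡ false → TransClosure (Arc O) x y) →
    ∃[ w ] indeg O w ≡ 0 × Star (Arc O) w x
  reachable-from-source-within zero U count≡0 Ux _ = contradiction count≡0 (count-nonzero U Ux)
  reachable-from-source-within (suc k) U {x} count≡ Ux above
    with any? (λ p → arc O p x Bool.≟ true)
  ... | no no-arc = x , count-zero _ (λ p → ¬-not λ p→x → no-arc (p , p→x)) , ε
  ... | yes (p , p→x) =
    let w , source , path = reachable-from-source-within k (U ─ x) count′ U′p above′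
    in w , source , path ◅◅ (p→x ◅ ε)
    where
    p≢x : p ≢ x
    p≢x refl = contradiction (trans (sym (arc-edge O x x p→x)) (irref G x)) λ ()
    U′p : (U ─ x) p ≡ true
    U′p = trans (─-other U p≢x) (¬-not λ Up≡false → acyclic p (p→x ∷ above p Up≡false))
    count′ : count (U ─ x) ≡ k
    count′ = suc-injective (trans (sym (count-remove U Ux)) count≡)
    above′ : ∀ y → (U ─ x) y ≡ false → TransClosure (Arc O) p y
    above′ y U′y with y ≟ x
    ... | yes refl = [ p→x ]
    ... | no  y≢x  = p→x ∷ above y (trans (sym (∧-identityʳ (U y))) U′y)

  reachable-from-source : ∀ x → ∃[ w ] indeg O w ≡ 0 × Star (Arc O) w x
  reachable-from-source x = reachable-from-source-within _ (λ _ → true) refl refl λ _ ()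

condP-from-source-parity : ∀ {n} (G : Graph n) (T : Fin n → Bool) →
  isOdd (numEdges G + n) ≡ isOdd (count (Source T)) → CondP G T
condP-from-source-parity {n} G T parity = xor-≡ʳ⇒false _ _ (begin
  isOdd (numEdges G + count T) xor isOdd (count (Source T)) ≡⟨ isOdd-+ (numEdges G + count T) _ ⟨
  isOdd (numEdges G + count T + count (Source T))            ≡⟨ cong isOdd (+-assoc (numEdges G) _ _) ⟩
  isOdd (numEdges G + (count T + count (Source T)))          ≡⟨ cong (λ m → isOdd (numEdges G + m)) (count-complement T) ⟩
  isOdd (numEdges G + n)                                     ≡⟨ parity ⟩
  isOdd (count (Source T))                                   ∎)
  where open ≡-Reasoning

source-sink-conditions : ∀ {n} (G : Graph n) (T : Fin n → Bool) {a x} →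
  Source T a ≡ true → Sink G T x ≡ true → Source T x ≡ false ⊎ 2 ≤ count (Source T) →
  CondS G T × CondSbar G T
source-sink-conditions G T {a} {x} source sink separated =
  (count-nonzero (Source T) source , λ one → inj₂ (differ separated one)) ,
  (count-nonzero (Sink G T) sink ,
   λ one → inj₂ λ same → differ separated (trans (count-ext (sym ∘ same)) one) (sym ∘ same))
  where
  differ : Source T x ≡ false ⊎ 2 ≤ count (Source T) → count (Source T) ≡ 1 →
           ¬ (∀ v → Source T v ≡ Sink G T v)
  differ (inj₁ x∉source) _   same = contradiction (trans (sym x∉source) (trans (same x) sink)) λ ()
  differ (inj₂ 2≤count)  one _    = contradiction (subst (2 ≤_) one 2≤count) λ { (s≤s ()) }

Walk : ∀ {n} → Graph n → Fin n → Fin n → Set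
Walk G = Star (λ x y → adj G x y ≡ true)

module _ {n} (G : Graph n) where

  adj⇒≢ : ∀ {x y} → adj G x y ≡ true → x ≢ y
  adj⇒≢ {x} x-x refl = contradiction (trans (sym x-x) (irref G x)) λ ()

  walk-reverse : ∀ {x y} → Walk G x y → Walk G y x
  walk-reverse = reverse λ {x} {y} x-y → trans (Graph.sym G y x) x-y

  walk-to-isolated : ∀ {w x} → deg G x ≡ 0 → Walk G w x → w ≡ x
  walk-to-isolated deg≡0 ε = refl
  walk-to-isolated deg≡0 (w-y ◅ walk) with refl ← walk-to-isolated deg≡0 walk =
    contradiction deg≡0 (count-nonzero (adj G _) (trans (Graph.sym G _ _) w-y))

  ∁ : List (Fin n) → Fin n → Bool
  ∁ M x = not (does (x ∈? M))

  ∁-false⇒∈ : ∀ {M x} → ∁ M x ≡ false → x ∈ M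
  ∁-false⇒∈ {M} {x} ∁Mx with x ∈? M
  ... | yes x∈M = x∈M
  ... | no  _   = contradiction ∁Mx λ ()

  sink-∈ : ∀ {M x} → x ∈ M → isOdd (deg G x) ≡ false → Sink G (∁ M) x ≡ true
  sink-∈ {M} {x} x∈M even rewrite dec-true (x ∈? M) x∈M | even = refl

  sink-∉ : ∀ {M x} → x ∉ M → isOdd (deg G x) ≡ true → Sink G (∁ M) x ≡ true
  sink-∉ {M} {x} x∉M odd rewrite dec-false (x ∈? M) x∉M | odd = refl

  non-sink-∉⇒even : ∀ {M x} → x ∉ M → Sink G (∁ M) x ≡ false → isOdd (deg G x) ≡ false
  non-sink-∉⇒even {M} {x} x∉M non-sink rewrite dec-false (x ∈? M) x∉M = non-sink

  OddVertexBesides : Fin n → Set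
  OddVertexBesides u = ∃[ x ] x ≢ u × isOdd (deg G x) ≡ true

  odd-vertex-besides? : ∀ u → Dec (OddVertexBesides u)
  odd-vertex-besides? u = any? λ x → ¬? (x ≟ u) ×-dec (isOdd (deg G x) Bool.≟ true)

  all-even : ∀ {u v} → u ≢ v → ¬ OddVertexBesides u → ¬ OddVertexBesides v →
             ∀ x → isOdd (deg G x) ≡ false
  all-even {u} {v} u≢v none-u none-v x = ¬-not λ x-odd →
    u≢v (trans (sym (x≡ none-u x-odd)) (x≡ none-v x-odd))
    where
    x≡ : ∀ {w} → ¬ OddVertexBesides w → isOdd (deg G x) ≡ true → x ≡ w
    x≡ {w} none x-odd = decidable-stable (x ≟ w) λ x≢w → none (x , x≢w , x-odd)

  MeetsEveryComponent : List (Fin n) → Set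
  MeetsEveryComponent M = ∀ v → ∃[ w ] w ∈ M × Walk G w v

  centre-connects : ∀ {u N} → All (λ y → adj G u y ≡ true) N →
                    MeetsEveryComponent (u ∷ N) → ∀ v → Walk G u v
  centre-connects u-N meets v =
    let w , w∈ , walk = meets v in All.lookup (ε ∷ All.map (_◅ ε) u-N) w∈ ◅◅ walk

  isolated-∈ : ∀ {M y} → MeetsEveryComponent M → deg G y ≡ 0 → y ∈ M
  isolated-∈ {M} {y} meets deg≡0 =
    let w , w∈ , walk = meets y in subst (_∈ M) (walk-to-isolated deg≡0 walk) w∈

module _ {n} (G : Graph n) (inC : InC-PSSbar G) where

  walk-from-outside : ∀ T → CondP G T → CondS G T → CondSbar G T →
                      ∀ v → ∃[ w ] T w ≡ false × Walk G w v
  walk-from-outside T condP condS condSbar v =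
    let O , T-odd , acyclic    = inC T condP condS condSbar
        w , indeg≡0 , arcs     = reachable-from-source O acyclic v
    in w , trans (sym (T-odd w)) (cong isOdd indeg≡0) , Star.map (arc-edge O _ _) arcs

  meets-every-component : ∀ a N {x} → Unique (a ∷ N) →
    isOdd (numEdges G + n) ≡ isOdd (suc (length N)) →
    Sink G (∁ G (a ∷ N)) x ≡ true → x ∉ a ∷ N ⊎ 1 ≤ length N →
    MeetsEveryComponent G (a ∷ N)
  meets-every-component a N {x} unique parity sink separated v =
    let condS , condSbar = source-sink-conditions G T a∈source sink separated′
        w , ∁w , walk    = walk-from-outside T condP condS condSbar v
    in w , ∁-false⇒∈ G ∁w , walk
    where
    M : List (Fin n)
    M = a ∷ N
    T : Fin n → Bool
    T = ∁ G M
    source≗ : Source T ≗ λ y → does (y ∈? M)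
    source≗ y = not-involutive _
    count-source : count (Source T) ≡ suc (length N)
    count-source = trans (count-ext source≗) (count-∈? unique)
    condP : CondP G T
    condP = condP-from-source-parity G T (trans parity (cong isOdd (sym count-source)))
    a∈source : Source T a ≡ true
    a∈source = trans (source≗ a) (dec-true (a ∈? M) (here refl))
    separated′ : Source T x ≡ false ⊎ 2 ≤ count (Source T)
    separated′ = Sum.map (λ x∉M → trans (source≗ x) (dec-false (x ∈? M) x∉M))
                         (λ 1≤ → subst (2 ≤_) (sym count-source) (s≤s 1≤)) separated

  no-isolated-vertex : 4 ≤ n → isOdd (numEdges G + n) ≡ false → ∀ y → deg G y ≢ 0
  no-isolated-vertex 4≤n even-size y isolated
    with three-others 4≤n y
  ... | a , b , c , (y≢a ∷ y≢b ∷ y≢c ∷ []) ∷ (a≢b ∷ a≢c ∷ []) ∷ (b≢c ∷ []) ∷ [] ∷ []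
    with isOdd (deg G a) in a-parity
  -- a is a sink: of even degree inside {a, b}, or of odd degree outside {b, c}.
  ... | false = All¬⇒¬Any (y≢a ∷ y≢b ∷ []) (isolated-∈ G meets isolated)
    where
    meets : MeetsEveryComponent G (a ∷ b ∷ [])
    meets = meets-every-component a (b ∷ []) ((a≢b ∷ []) ∷ [] ∷ []) even-size
              (sink-∈ G {a ∷ b ∷ []} (here refl) a-parity) (inj₂ (s≤s z≤n))
  ... | true  = All¬⇒¬Any (y≢b ∷ y≢c ∷ []) (isolated-∈ G meets isolated)
    where
    meets : MeetsEveryComponent G (b ∷ c ∷ [])
    meets = meets-every-component b (c ∷ []) ((b≢c ∷ []) ∷ [] ∷ []) even-size
              (sink-∉ G (All¬⇒¬Any (a≢b ∷ a≢c ∷ [])) a-parity) (inj₂ (s≤s z≤n))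

  connects-through-edge : isOdd (numEdges G + n) ≡ false → ∀ {u y x} → adj G u y ≡ true →
                          Sink G (∁ G (u ∷ y ∷ [])) x ≡ true → ∀ v → Walk G u v
  connects-through-edge even-size u-y sink = centre-connects G (u-y ∷ [])
    (meets-every-component _ (_ ∷ []) ((adj⇒≢ G u-y ∷ []) ∷ [] ∷ []) even-size sink (inj₂ (s≤s z≤n)))

  connected-even : 4 ≤ n → isOdd (numEdges G + n) ≡ false → ∀ {u v} → u ≢ v → Walk G u v
  connected-even 4≤n even-size {u} {v} u≢v
    with count-nonzero⇒∃ (adj G u) (no-isolated-vertex 4≤n even-size u)
       | count-nonzero⇒∃ (adj G v) (no-isolated-vertex 4≤n even-size v)
  ... | y , u-y | y′ , v-y′ with any? (λ x → Sink G (∁ G (u ∷ y ∷ [])) x Bool.≟ true)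
  ... | yes (_ , sink) = connects-through-edge even-size u-y sink v
  -- Without a sink for V ∖ {u, y}, the vertex v has even degree unless v ∈ {u, y}.
  ... | no  no-sink with v ≟ y
  ...   | yes refl = u-y ◅ ε
  ...   | no  v≢y  =
    walk-reverse G (connects-through-edge even-size v-y′ (sink-∈ G {v ∷ y′ ∷ []} (here refl) v-even) u)
    where
    v-even : isOdd (deg G v) ≡ false
    v-even = non-sink-∉⇒even G (All¬⇒¬Any (≢-sym u≢v ∷ v≢y ∷ [])) (¬-not λ sink → no-sink (v , sink))

  connects-from-singleton : isOdd (numEdges G + n) ≡ true → ∀ {u x} → x ≢ u →
                            isOdd (deg G x) ≡ true → ∀ v → Walk G u v
  connects-from-singleton odd-size {u} {x} x≢u x-odd = centre-connects G []
    (meets-every-component u [] ([] ∷ []) odd-size (sink-∉ G x∉ x-odd) (inj₁ x∉))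
    where
    x∉ : x ∉ u ∷ []
    x∉ = All¬⇒¬Any (x≢u ∷ [])

  connected-all-even : 4 ≤ n → isOdd (numEdges G + n) ≡ true →
                       (∀ x → isOdd (deg G x) ≡ false) → ∀ u v → Walk G u v
  connected-all-even 4≤n odd-size even u v with even⇒≡0⊎≥2 (even u)
  ... | inj₁ isolated with three-others 4≤n u
  ...   | a , b , c , u∉abc ∷ unique = ⊥-elim (All¬⇒¬Any u∉abc (isolated-∈ G meets isolated))
    where
    meets : MeetsEveryComponent G (a ∷ b ∷ c ∷ [])
    meets = meets-every-component a (b ∷ c ∷ []) unique odd-size
              (sink-∈ G {a ∷ b ∷ c ∷ []} (here refl) (even a)) (inj₂ (s≤s z≤n))
  connected-all-even 4≤n odd-size even u v | inj₂ 2≤deg with count≥2⇒∃₂ (adj G u) 2≤deg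
  ... | y , z , y≢z , u-y , u-z = centre-connects G (u-y ∷ u-z ∷ []) meets v
    where
    unique : Unique (u ∷ y ∷ z ∷ [])
    unique = (adj⇒≢ G u-y ∷ adj⇒≢ G u-z ∷ []) ∷ (y≢z ∷ []) ∷ [] ∷ []
    meets : MeetsEveryComponent G (u ∷ y ∷ z ∷ [])
    meets = meets-every-component u (y ∷ z ∷ []) unique odd-size
              (sink-∈ G {u ∷ y ∷ z ∷ []} (here refl) (even u)) (inj₂ (s≤s z≤n))

  connected-odd : 4 ≤ n → isOdd (numEdges G + n) ≡ true → ∀ {u v} → u ≢ v → Walk G u v
  connected-odd 4≤n odd-size {u} {v} u≢v with odd-vertex-besides? G u | odd-vertex-besides? G v
  ... | yes (x , x≢u , x-odd) | _   = connects-from-singleton odd-size x≢u x-odd v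
  ... | no _ | yes (x , x≢v , x-odd) = walk-reverse G (connects-from-singleton odd-size x≢v x-odd u)
  ... | no none-u | no none-v        = connected-all-even 4≤n odd-size (all-even G u≢v none-u none-v) u v

lemma2 : ∀ {n : ℕ} (G : Graph n) → InC-PSSbar G → n ≥ 4 → Connected G
lemma2 G inC 4≤n u v with u ≟ v | isOdd (numEdges G + _) in parity
... | yes refl | _     = ε
... | no  u≢v  | true  = connected-odd G inC 4≤n parity u≢v
... | no  u≢v  | false = connected-even G inC 4≤n parity u≢v
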